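{- Let $k\ge 2$, let $G$ be a $K_k$-free graph on $n$ vertices containing an independent set $A$ of size $a$, and let $H$ be a complete multipartite graph. Then there is a complete $(k-1)$-partite graph $G'$ on $n$ vertices with $\mathcal{N}(H,G)\le \mathcal{N}(H,G')$ such that one of the parts of $G'$ has size at least $a$.
   Context: $\mathcal{N}(H,G)$ denotes the number of subgraphs of $G$ isomorphic to $H$. A complete $(k-1)$-partite graph has its vertex set partitioned into $k-1$ parts (possibly empty), with two vertices adjacent iff they lie in different parts. -}

module Defs where

open import Data.Nat using (ℕ; zero; suc; _≤_; _∸_)
open import Data.Bool using (Bool; true; false; _∧_; _∨_; not)
import Data.Bool as B
open import Data.Fin using (Fin; _≟_)
open import Data.Vec using (Vec; []; _∷_; lookup)
open import Data.List using (List; []; _∷_; map; concatMap; allFin; length; filterᵇ)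
open import Data.Bool.ListAction using (all; any)
open import Data.Product using (Σ; _×_; _,_; ∃)
open import Relation.Nullary.Decidable using (⌊_⌋)
open import Relation.Nullary using (¬_)
open import Relation.Binary.PropositionalEquality using (_≡_; _≢_)
open import Function.Bundles using (_⇔_)

record Graph (n : ℕ) : Set where
  field
    adj    : Fin n → Fin n → Bool
    sym    : ∀ u v → adj u v ≡ adj v u
    irrefl : ∀ u → adj u u ≡ false
open Graph public

_==_ : ∀ {m} → Fin m → Fin m → Bool
i == j = ⌊ i ≟ j ⌋

_⇔ᵇ_ : Bool → Bool → Bool
x ⇔ᵇ y = ⌊ x B.≟ y ⌋

allF : ∀ m → (Fin m → Bool) → Bool
allF m p = all p (allFin m)

anyF : ∀ m → (Fin m → Bool) → Bool
anyF m p = any p (allFin m)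

vecs : ∀ {A : Set} → List A → (m : ℕ) → List (Vec A m)
vecs xs zero    = [] ∷ []
vecs xs (suc m) = concatMap (λ x → map (x ∷_) (vecs xs m)) xs

allBools : List Bool
allBools = true ∷ false ∷ []

-- A candidate subgraph of a graph on Fin n: vertex set S (characteristic vector)
-- and edge set E (characteristic matrix).
VSet : ℕ → Set
VSet n = Vec Bool n

ESet : ℕ → Set
ESet n = Vec (Vec Bool n) n

-- (S , E) is a subgraph of G isomorphic to H, witnessed by the vector f
-- (a map Fin h → Fin n) being a bijection from V(H) onto S that carries
-- the edges of H exactly onto E.
isCopyVia : ∀ {h n} → Graph h → Graph n → VSet n → ESet n → Vec (Fin n) h → Bool
isCopyVia {h} {n} H G S E f =
  allF h (λ i → allF h (λ j → not (lookup f i == lookup f j) ∨ (i == j)))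
  ∧ allF n (λ v → lookup S v ⇔ᵇ anyF h (λ i → lookup f i == v))
  ∧ allF h (λ i → allF h (λ j → lookup (lookup E (lookup f i)) (lookup f j) ⇔ᵇ adj H i j))
  ∧ allF n (λ u → allF n (λ v → not (lookup (lookup E u) v) ∨ (lookup S u ∧ lookup S v)))
  ∧ allF n (λ u → allF n (λ v → not (lookup (lookup E u) v) ∨ adj G u v))

isCopy : ∀ {h n} → Graph h → Graph n → VSet n → ESet n → Bool
isCopy {h} {n} H G S E = any (isCopyVia H G S E) (vecs (allFin n) h)

candidates : (n : ℕ) → List (VSet n × ESet n)
candidates n = concatMap (λ S → map (S ,_) (vecs (vecs allBools n) n)) (vecs allBools n)

𝒩 : ∀ {h n} → Graph h → Graph n → ℕ
𝒩 H G = length (filterᵇ (λ { (S , E) → isCopy H G S E }) (candidates _))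

Injective : ∀ {a n} → (Fin a → Fin n) → Set
Injective {a} f = ∀ (i j : Fin a) → f i ≡ f j → i ≡ j

KFree : ∀ {n} → ℕ → Graph n → Set
KFree {n} k G = ¬ (Σ (Fin k → Fin n) λ f →
  Injective f × (∀ i j → i ≢ j → adj G (f i) (f j) ≡ true))

IsIndependentSet : ∀ {a n} → Graph n → (Fin a → Fin n) → Set
IsIndependentSet G A = Injective A × (∀ i j → adj G (A i) (A j) ≡ false)

-- G is complete multipartite with parts indexed by Fin m, given by part map p
-- (parts may be empty)
IsCompletePartiteVia : ∀ {n} (m : ℕ) → Graph n → (Fin n → Fin m) → Set
IsCompletePartiteVia {n} m G p = ∀ (u v : Fin n) → (adj G u v ≡ true) ⇔ (p u ≢ p v)

IsCompleteMultipartite : ∀ {n} → Graph n → Set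
IsCompleteMultipartite {n} G = Σ ℕ λ m → Σ (Fin n → Fin m) λ p → IsCompletePartiteVia m G p

partSize : ∀ {n m} → (Fin n → Fin m) → Fin m → ℕ
partSize {n} p c = length (filterᵇ (λ u → p u == c) (allFin n))

-- Zykov symmetrization. For non-adjacent u, v let clone G u v replace v by a twin of u, and let
-- D(u,v) count the copies of H through u but not v. Copies avoiding v survive; so do copies through
-- both u and v, because u and v are non-adjacent in the copy and hence lie in one part of the complete
-- multipartite H; copies through u but not v are moved onto v by the transposition (u v). Hence
-- 𝒩(H, clone G u v) + D(v,u) ≥ 𝒩(H, G) + D(u,v), so cloning u onto v when D(u,v) ≥ D(v,u) loses no
-- copies; on ties u is taken with at least as many twins as v, which increases the number of ordered
-- twin pairs. Cloning preserves K_k-freeness, and, when pairs inside A are symmetrized first, the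
-- independence of A. The process ends in a graph where non-adjacent vertices are twins: a complete
-- multipartite graph whose parts are its twin classes, at most k − 1 of them by K_k-freeness, one of
-- which contains A.

module Submission where

open import Defs hiding (sym)

open import Data.Bool using (Bool; true; false; not; _∧_; _∨_; T?)
import Data.Bool as Bool
open import Data.Bool.Properties using (T-≡; ∧-conicalˡ; ∧-conicalʳ; ⇔→≡)
open import Data.Empty using (⊥-elim)
open import Data.Fin using (Fin; _≟_; punchIn; inject≤)
import Data.Fin as Fin
open import Data.Fin.Permutation using (Permutation′; _⟨$⟩ʳ_; _⟨$⟩ˡ_; inverseˡ; inverseʳ; transpose)
import Data.Fin.Permutation.Components as Transposition
open import Data.Fin.Properties using (all?; ¬∀⟶∃¬; punchInᵢ≢i; inject≤-injective)
open import Data.List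
  using (List; []; _∷_; _++_; map; concatMap; length; filterᵇ; cartesianProductWith; allFin; deduplicate)
import Data.List as List
open import Data.List.Membership.Propositional using (_∈_)
open import Data.List.Membership.Propositional.Properties
  using (∈-map⁻; ∈-filter⁺; ∈-filter⁻; ∈-cartesianProductWith⁺; ∈-allFin; ∈-lookup)
open import Data.List.Properties using (length-map; length-removeAt′; length-filter; length-tabulate)
open import Data.List.Relation.Binary.Subset.Propositional using (_⊆_)
open import Data.List.Relation.Unary.All as All using (All)
open import Data.List.Relation.Unary.All.Properties using (all⁺; all⁻)
open import Data.List.Relation.Unary.Any as Any using (Any; here; there; _─_)
open import Data.List.Relation.Unary.Any.Properties using (any⁺; any⁻; deduplicate⁺; lookup-index)
open import Data.List.Relation.Unary.Unique.DecSetoid.Properties using (deduplicate-!)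
open import Data.List.Relation.Unary.Unique.Propositional using (Unique; []; _∷_)
import Data.List.Relation.Unary.Unique.Propositional.Properties as Unique
open import Data.Nat using (ℕ; zero; suc; _+_; _*_; _∸_; _≤_; _<_; z≤n; s≤s)
open import Data.Nat.Induction using (<-wellFounded)
open import Data.Nat.Properties
  using (≤-refl; ≤-reflexive; ≤-trans; ≤-<-trans; ≤-antisym; ≤-total; _≤?_; ≰⇒>; <⇒≤; <-cmp; m≤m+n; m≤n⇒m≤1+n;
         +-comm; +-suc; +-mono-≤; +-monoˡ-≤; +-monoʳ-≤; +-monoʳ-<; +-mono-<-≤; +-mono-≤-<; +-cancelʳ-≤; +-cancelʳ-<;
         *-identityʳ; *-monoˡ-≤; ∸-monoʳ-<; +-0-commutativeMonoid; module ≤-Reasoning)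
open import Data.Nat.Tactic.RingSolver using (solve-∀)
open import Algebra.Properties.CommutativeMonoid.Sum +-0-commutativeMonoid
  using (sum-syntax; sum-remove; sum-cong-≗; ∑-distrib-+)
open import Data.Product using (Σ; _×_; _,_; proj₁; proj₂; ∃; uncurry)
import Data.Product.Properties as Product
open import Data.Sum using (_⊎_; inj₁; inj₂)
open import Data.Vec using (Vec; []; _∷_; lookup; tabulate)
import Data.Vec.Properties as Vec
open import Function using (_∘_; _$_; _on_; id; const)
open import Function.Bundles using (Equivalence; mk⇔)
open import Induction.WellFounded using (Acc; acc)
open import Level using (0ℓ)
open import Relation.Binary.Bundles using (Setoid; DecSetoid)
import Relation.Binary.Construct.On as On
open import Relation.Binary.Definitions using (Tri; tri<; tri≈; tri>)
open import Relation.Binary.PropositionalEquality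
  using (_≡_; _≢_; refl; sym; trans; cong; cong₂; subst; subst₂; module ≡-Reasoning)
open import Relation.Nullary using (Dec; yes; no; ¬_)
open import Relation.Nullary.Decidable using (toWitness; fromWitness; decidable-stable; _→-dec_)

count : {A : Set} → (A → Bool) → List A → ℕ
count P xs = length (filterᵇ P xs)

module _ {A : Set} where

  count-cong : (P Q : A → Bool) (xs : List A) → (∀ x → P x ≡ Q x) → count P xs ≡ count Q xs
  count-cong P Q []       P≗Q = refl
  count-cong P Q (x ∷ xs) P≗Q with P x | Q x | P≗Q x
  ... | true  | .true  | refl = cong suc (count-cong P Q xs P≗Q)
  ... | false | .false | refl = count-cong P Q xs P≗Q

  count-mono : (P Q : A → Bool) (xs : List A) → (∀ x → P x ≡ true → Q x ≡ true) →
               count P xs ≤ count Q xs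
  count-mono P Q []       P⇒Q = z≤n
  count-mono P Q (x ∷ xs) P⇒Q with P x | Q x | P⇒Q x
  ... | true  | true  | _ = s≤s (count-mono P Q xs P⇒Q)
  ... | true  | false | h with () ← h refl
  ... | false | true  | _ = m≤n⇒m≤1+n (count-mono P Q xs P⇒Q)
  ... | false | false | _ = count-mono P Q xs P⇒Q

  count-split : (P Q : A → Bool) (xs : List A) →
                count P xs ≡ count (λ x → P x ∧ Q x) xs + count (λ x → P x ∧ not (Q x)) xs
  count-split P Q [] = refl
  count-split P Q (x ∷ xs) with P x | Q x
  ... | true  | true  = cong suc (count-split P Q xs)
  ... | true  | false = trans (cong suc (count-split P Q xs)) (sym (+-suc _ _))
  ... | false | _     = count-split P Q xs

  count≤length : (P : A → Bool) (xs : List A) → count P xs ≤ length xs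
  count≤length P = length-filter (λ x → T? (P x))

  ∈-─⁺ : ∀ {x z} {ys : List A} (x∈ys : x ∈ ys) → z ∈ ys → z ≢ x → z ∈ (ys ─ x∈ys)
  ∈-─⁺ (here refl)  (here refl) z≢x = ⊥-elim (z≢x refl)
  ∈-─⁺ (here refl)  (there z∈ys) _  = z∈ys
  ∈-─⁺ (there x∈ys) (here refl) _   = here refl
  ∈-─⁺ (there x∈ys) (there z∈ys) z≢x = there (∈-─⁺ x∈ys z∈ys z≢x)

  length-mono-⊆ : ∀ {xs ys : List A} → Unique xs → xs ⊆ ys → length xs ≤ length ys
  length-mono-⊆ {[]}     _              _  = z≤n
  length-mono-⊆ {x ∷ xs} {ys} (x≢xs ∷ !xs) xs⊆ys = ≤-trans
    (s≤s (length-mono-⊆ !xs λ z∈xs →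
      ∈-─⁺ x∈ys (xs⊆ys (there z∈xs)) (λ z≡x → All.lookup x≢xs z∈xs (sym z≡x))))
    (≤-reflexive (sym (length-removeAt′ ys (Any.index x∈ys))))
    where x∈ys = xs⊆ys (here refl)

  count-mono-injection : ∀ {L : List A} → Unique L → (f : A → A) → (∀ {x y} → f x ≡ f y → x ≡ y) →
                         (∀ x → f x ∈ L) → (P Q : A → Bool) → (∀ x → P x ≡ true → Q (f x) ≡ true) →
                         count P L ≤ count Q L
  count-mono-injection {L} !L f f-inj f∈L P Q P⇒Qf = subst (_≤ count Q L) (length-map f (filterᵇ P L))
    (length-mono-⊆ (Unique.map⁺ f-inj (Unique.filter⁺ (λ x → T? (P x)) !L)) image⊆)
    where
    image⊆ : map f (filterᵇ P L) ⊆ filterᵇ Q L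
    image⊆ z∈ with x , x∈ , refl ← ∈-map⁻ f z∈ =
      ∈-filter⁺ (λ y → T? (Q y)) (f∈L x)
        (Equivalence.from T-≡ (P⇒Qf x (Equivalence.to T-≡ (proj₂ (∈-filter⁻ (λ y → T? (P y)) {xs = L} x∈)))))

concatMap-map : {A B C : Set} (f : A → B → C) (xs : List A) (ys : List B) →
                concatMap (λ x → map (f x) ys) xs ≡ cartesianProductWith f xs ys
concatMap-map f []       ys = refl
concatMap-map f (x ∷ xs) ys = cong (map (f x) ys ++_) (concatMap-map f xs ys)

module _ {A : Set} {xs : List A} where

  vecs-unique : Unique xs → ∀ m → Unique (vecs xs m)
  vecs-unique !xs zero    = All.[] ∷ []
  vecs-unique !xs (suc m) = subst Unique (sym (concatMap-map _∷_ xs (vecs xs m)))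
    (Unique.cartesianProductWith⁺ _∷_ Vec.∷-injective !xs (vecs-unique !xs m))

  ∈-vecs : (∀ x → x ∈ xs) → ∀ {m} (w : Vec A m) → w ∈ vecs xs m
  ∈-vecs ∈xs []      = here refl
  ∈-vecs ∈xs {suc m} (x ∷ w) = subst (x ∷ w ∈_) (sym (concatMap-map _∷_ xs (vecs xs m)))
    (∈-cartesianProductWith⁺ _∷_ (∈xs x) (∈-vecs ∈xs w))

allBools-unique : Unique allBools
allBools-unique = ((λ ()) All.∷ All.[]) ∷ All.[] ∷ []

∈-allBools : ∀ b → b ∈ allBools
∈-allBools true  = here refl
∈-allBools false = there (here refl)

Candidate : ℕ → Set
Candidate n = VSet n × ESet n

candidates-unique : ∀ n → Unique (candidates n)
candidates-unique n = subst Unique (sym (concatMap-map _,_ (vecs allBools n) (vecs (vecs allBools n) n)))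
  (Unique.cartesianProductWith⁺ _,_ Product.,-injective
    (vecs-unique allBools-unique n) (vecs-unique (vecs-unique allBools-unique n) n))

∈-candidates : ∀ {n} (c : Candidate n) → c ∈ candidates n
∈-candidates {n} (S , E) = subst ((S , E) ∈_) (sym (concatMap-map _,_ (vecs allBools n) (vecs (vecs allBools n) n)))
  (∈-cartesianProductWith⁺ _,_ (∈-vecs ∈-allBools S) (∈-vecs (∈-vecs ∈-allBools) E))

private
  ∧-elim : ∀ {a b} → a ∧ b ≡ true → a ≡ true × b ≡ true
  ∧-elim {a} {b} a∧b = ∧-conicalˡ a b a∧b , ∧-conicalʳ a b a∧b

  ∧-intro : ∀ {a b} → a ≡ true → b ≡ true → a ∧ b ≡ true
  ∧-intro refl refl = refl

  ⇒ᵇ-elim : ∀ {a b} → not a ∨ b ≡ true → a ≡ true → b ≡ true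
  ⇒ᵇ-elim {true} a⇒b refl = a⇒b

  ⇒ᵇ-intro : ∀ {a b} → (a ≡ true → b ≡ true) → not a ∨ b ≡ true
  ⇒ᵇ-intro {false} _   = refl
  ⇒ᵇ-intro {true}  a⇒b = a⇒b refl

  ⇔ᵇ-elim : ∀ {a b} → a ⇔ᵇ b ≡ true → a ≡ b
  ⇔ᵇ-elim {a} {b} a⇔b = toWitness {a? = a Bool.≟ b} (Equivalence.from T-≡ a⇔b)

  ⇔ᵇ-intro : ∀ {a b} → a ≡ b → a ⇔ᵇ b ≡ true
  ⇔ᵇ-intro {a} {b} a≡b = Equivalence.to T-≡ (fromWitness {a? = a Bool.≟ b} a≡b)

  ==-sound : ∀ {m} {i j : Fin m} → i == j ≡ true → i ≡ j
  ==-sound {i = i} {j} i==j = toWitness {a? = i ≟ j} (Equivalence.from T-≡ i==j)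

  ==-complete : ∀ {m} {i j : Fin m} → i ≡ j → i == j ≡ true
  ==-complete {i = i} {j} i≡j = Equivalence.to T-≡ (fromWitness {a? = i ≟ j} i≡j)

  allF-elim : ∀ {m} {p : Fin m → Bool} → allF m p ≡ true → ∀ i → p i ≡ true
  allF-elim {m} {p} all-p i = Equivalence.to T-≡ (All.lookup (all⁺ p (allFin m) (Equivalence.from T-≡ all-p)) (∈-allFin i))

  allF-intro : ∀ {m} {p : Fin m → Bool} → (∀ i → p i ≡ true) → allF m p ≡ true
  allF-intro {m} {p} p-all =
    Equivalence.to T-≡ (all⁻ p {xs = allFin m} (All.tabulate (λ {i} _ → Equivalence.from T-≡ (p-all i))))

  anyF-elim : ∀ {m} {p : Fin m → Bool} → anyF m p ≡ true → ∃ λ i → p i ≡ true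
  anyF-elim {m} {p} any-p with i , pi ← Any.satisfied (any⁻ p (allFin m) (Equivalence.from T-≡ any-p)) =
    i , Equivalence.to T-≡ pi

  anyF-intro : ∀ {m} {p : Fin m → Bool} i → p i ≡ true → anyF m p ≡ true
  anyF-intro {m} {p} i pi = Equivalence.to T-≡ (any⁺ p (Any.map (λ { refl → Equivalence.from T-≡ pi }) (∈-allFin i)))

entry : ∀ {n} → ESet n → Fin n → Fin n → Bool
entry E x y = lookup (lookup E x) y

IsHomomorphism : ∀ {h n} → Graph h → Graph n → (Fin h → Fin n) → Set
IsHomomorphism H G f = ∀ i j → adj H i j ≡ true → adj G (f i) (f j) ≡ true

-- The conditions of isCopyVia that do not mention the host graph; the remaining one is
-- IsHomomorphism H G embed, which is what changes when the host graph is modified.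
record Copy {h n} (H : Graph h) (S : VSet n) (E : ESet n) : Set where
  field
    embed           : Fin h → Fin n
    embed-injective : Injective embed
    image⁺          : ∀ x → lookup S x ≡ true → ∃ λ i → embed i ≡ x
    image⁻          : ∀ i → lookup S (embed i) ≡ true
    entry-embed     : ∀ i j → entry E (embed i) (embed j) ≡ adj H i j
    entry-inside    : ∀ x y → entry E x y ≡ true → lookup S x ≡ true × lookup S y ≡ true

  entry⇒edge : ∀ x y → entry E x y ≡ true →
               ∃ λ i → ∃ λ j → embed i ≡ x × embed j ≡ y × adj H i j ≡ true
  entry⇒edge x y Exy
    with i , refl ← image⁺ x (proj₁ (entry-inside x y Exy))
       | j , refl ← image⁺ y (proj₂ (entry-inside x y Exy)) =
    i , j , refl , refl , trans (sym (entry-embed i j)) Exy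

module _ {h n} (H : Graph h) (G : Graph n) (S : VSet n) (E : ESet n) where

  private
    injectiveᵇ imageᵇ entriesᵇ insideᵇ inGᵇ : Vec (Fin n) h → Bool
    injectiveᵇ fv = allF h (λ i → allF h (λ j → not (lookup fv i == lookup fv j) ∨ (i == j)))
    imageᵇ     fv = allF n (λ v → lookup S v ⇔ᵇ anyF h (λ i → lookup fv i == v))
    entriesᵇ   fv = allF h (λ i → allF h (λ j → lookup (lookup E (lookup fv i)) (lookup fv j) ⇔ᵇ adj H i j))
    insideᵇ    fv = allF n (λ u → allF n (λ v → not (lookup (lookup E u) v) ∨ (lookup S u ∧ lookup S v)))
    inGᵇ       fv = allF n (λ u → allF n (λ v → not (lookup (lookup E u) v) ∨ adj G u v))

  isCopyVia⇒Copy : ∀ fv → isCopyVia H G S E fv ≡ true →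
                   Σ (Copy H S E) λ c → IsHomomorphism H G (Copy.embed c)
  isCopyVia⇒Copy fv copy
    with injective , copy ← ∧-elim {injectiveᵇ fv} copy
    with image′    , copy ← ∧-elim {imageᵇ fv} copy
    with entries   , copy ← ∧-elim {entriesᵇ fv} copy
    with inside    , inG  ← ∧-elim {insideᵇ fv} copy = record
    { embed           = lookup fv
    ; embed-injective = λ i j fi≡fj → ==-sound (⇒ᵇ-elim (allF-elim (allF-elim injective i) j) (==-complete fi≡fj))
    ; image⁺          = λ x Sx → let i , fi==x = anyF-elim (subst (_≡ true) (image x) Sx) in i , ==-sound fi==x
    ; image⁻          = λ i → trans (image (lookup fv i)) (anyF-intro i (==-complete refl))
    ; entry-embed     = λ i j → ⇔ᵇ-elim (allF-elim (allF-elim entries i) j)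
    ; entry-inside    = λ x y Exy → ∧-elim (⇒ᵇ-elim (allF-elim (allF-elim inside x) y) Exy)
    } , λ i j Hij → ⇒ᵇ-elim (allF-elim (allF-elim inG (lookup fv i)) (lookup fv j))
                      (trans (⇔ᵇ-elim (allF-elim (allF-elim entries i) j)) Hij)
    where
    image : ∀ x → lookup S x ≡ anyF h (λ i → lookup fv i == x)
    image x = ⇔ᵇ-elim (allF-elim image′ x)

  Copy⇒isCopyVia : (c : Copy H S E) → IsHomomorphism H G (Copy.embed c) →
                   ∀ fv → (∀ i → lookup fv i ≡ Copy.embed c i) → isCopyVia H G S E fv ≡ true
  Copy⇒isCopyVia c hom fv fv≗embed = ∧-intro injective (∧-intro image (∧-intro entries (∧-intro inside inG)))
    where
    open Copy c
    injective : injectiveᵇ fv ≡ true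
    injective = allF-intro λ i → allF-intro λ j → ⇒ᵇ-intro λ fi==fj →
      ==-complete (embed-injective i j (trans (sym (fv≗embed i)) (trans (==-sound fi==fj) (fv≗embed j))))
    image : imageᵇ fv ≡ true
    image = allF-intro λ x → ⇔ᵇ-intro (⇔→≡ $ mk⇔
      (λ Sx → let i , fi≡x = image⁺ x Sx in anyF-intro i (==-complete (trans (fv≗embed i) fi≡x)))
      (λ some-fi==x → let i , fi==x = anyF-elim some-fi==x in
                 subst (λ y → lookup S y ≡ true) (trans (sym (fv≗embed i)) (==-sound fi==x)) (image⁻ i)))
    entries : entriesᵇ fv ≡ true
    entries = allF-intro λ i → allF-intro λ j →
      ⇔ᵇ-intro (trans (cong₂ (entry E) (fv≗embed i) (fv≗embed j)) (entry-embed i j))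
    inside : insideᵇ fv ≡ true
    inside = allF-intro λ x → allF-intro λ y → ⇒ᵇ-intro λ Exy → uncurry ∧-intro (entry-inside x y Exy)
    inG : inGᵇ fv ≡ true
    inG = allF-intro λ x → allF-intro λ y → ⇒ᵇ-intro λ Exy →
      let i , j , fi≡x , fj≡y , Hij = entry⇒edge x y Exy in subst₂ (λ x y → adj G x y ≡ true) fi≡x fj≡y (hom i j Hij)

  isCopy⇒Copy : isCopy H G S E ≡ true → Σ (Copy H S E) λ c → IsHomomorphism H G (Copy.embed c)
  isCopy⇒Copy copy with fv , copyVia ← Any.satisfied (any⁻ _ (vecs (allFin n) h) (Equivalence.from T-≡ copy)) =
    isCopyVia⇒Copy fv (Equivalence.to T-≡ copyVia)

  Copy⇒isCopy : (c : Copy H S E) → IsHomomorphism H G (Copy.embed c) → isCopy H G S E ≡ true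
  Copy⇒isCopy c hom = Equivalence.to T-≡ (any⁺ _ (Any.map (λ { refl → Equivalence.from T-≡ copyVia })
                                              (∈-vecs ∈-allFin (tabulate (Copy.embed c)))))
    where
    copyVia : isCopyVia H G S E (tabulate (Copy.embed c)) ≡ true
    copyVia = Copy⇒isCopyVia c hom (tabulate (Copy.embed c)) (Vec.lookup∘tabulate (Copy.embed c))

  module CopyIn (copy : isCopy H G S E ≡ true) where
    c : Copy H S E
    c = proj₁ (isCopy⇒Copy copy)
    open Copy c public
    hom : IsHomomorphism H G embed
    hom = proj₂ (isCopy⇒Copy copy)

≗-lookup⇒≡ : ∀ {A : Set} {m} {xs ys : Vec A m} → (∀ i → lookup xs i ≡ lookup ys i) → xs ≡ ys
≗-lookup⇒≡ {xs = xs} {ys} xs≗ys =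
  trans (sym (Vec.tabulate∘lookup xs)) (trans (Vec.tabulate-cong xs≗ys) (Vec.tabulate∘lookup ys))

module _ {n} (π : Permutation′ n) where

  relabel : Candidate n → Candidate n
  relabel (S , E) = tabulate (λ x → lookup S (π ⟨$⟩ˡ x))
                  , tabulate (λ x → tabulate (λ y → entry E (π ⟨$⟩ˡ x) (π ⟨$⟩ˡ y)))

  lookup-relabel : ∀ c x → lookup (proj₁ (relabel c)) x ≡ lookup (proj₁ c) (π ⟨$⟩ˡ x)
  lookup-relabel c = Vec.lookup∘tabulate _

  entry-relabel : ∀ c x y → entry (proj₂ (relabel c)) x y ≡ entry (proj₂ c) (π ⟨$⟩ˡ x) (π ⟨$⟩ˡ y)
  entry-relabel c x y = trans (cong (λ row → lookup row y) (Vec.lookup∘tabulate _ x)) (Vec.lookup∘tabulate _ y)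

  lookup-relabel-⟨$⟩ʳ : ∀ c x → lookup (proj₁ (relabel c)) (π ⟨$⟩ʳ x) ≡ lookup (proj₁ c) x
  lookup-relabel-⟨$⟩ʳ c x = trans (lookup-relabel c (π ⟨$⟩ʳ x)) (cong (lookup (proj₁ c)) (inverseˡ π))

  entry-relabel-⟨$⟩ʳ : ∀ c x y → entry (proj₂ (relabel c)) (π ⟨$⟩ʳ x) (π ⟨$⟩ʳ y) ≡ entry (proj₂ c) x y
  entry-relabel-⟨$⟩ʳ c x y =
    trans (entry-relabel c (π ⟨$⟩ʳ x) (π ⟨$⟩ʳ y)) (cong₂ (entry (proj₂ c)) (inverseˡ π) (inverseˡ π))

  relabel-injective : ∀ {c c′} → relabel c ≡ relabel c′ → c ≡ c′
  relabel-injective {c} {c′} eq = cong₂ _,_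
    (≗-lookup⇒≡ λ x → trans (sym (lookup-relabel-⟨$⟩ʳ c x))
      (trans (cong (λ d → lookup (proj₁ d) (π ⟨$⟩ʳ x)) eq) (lookup-relabel-⟨$⟩ʳ c′ x)))
    (≗-lookup⇒≡ λ x → ≗-lookup⇒≡ λ y → trans (sym (entry-relabel-⟨$⟩ʳ c x y))
      (trans (cong (λ d → entry (proj₂ d) (π ⟨$⟩ʳ x) (π ⟨$⟩ʳ y)) eq) (entry-relabel-⟨$⟩ʳ c′ x y)))

  Copy-relabel : ∀ {h} {H : Graph h} {S E} → Copy H S E → Copy H (proj₁ (relabel (S , E))) (proj₂ (relabel (S , E)))
  Copy-relabel {S = S} {E} c = record
    { embed           = λ i → π ⟨$⟩ʳ embed i
    ; embed-injective = λ i j eq →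
        embed-injective i j (trans (sym (inverseˡ π)) (trans (cong (π ⟨$⟩ˡ_) eq) (inverseˡ π)))
    ; image⁺          = λ x S′x → let i , fi≡ = image⁺ (π ⟨$⟩ˡ x) (trans (sym (lookup-relabel (S , E) x)) S′x) in
                                  i , trans (cong (π ⟨$⟩ʳ_) fi≡) (inverseʳ π)
    ; image⁻          = λ i → trans (lookup-relabel-⟨$⟩ʳ (S , E) (embed i)) (image⁻ i)
    ; entry-embed     = λ i j → trans (entry-relabel-⟨$⟩ʳ (S , E) (embed i) (embed j)) (entry-embed i j)
    ; entry-inside    = λ x y E′xy → let Sx , Sy = entry-inside _ _ (trans (sym (entry-relabel (S , E) x y)) E′xy) in
                                     trans (lookup-relabel (S , E) x) Sx , trans (lookup-relabel (S , E) y) Sy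
    }
    where open Copy c

-- Cloning a vertex

module _ {n} (i j : Fin n) where

  transpose-matchˡ : Transposition.transpose i j i ≡ j
  transpose-matchˡ with i ≟ i
  ... | yes _   = refl
  ... | no i≢i = ⊥-elim (i≢i refl)

  transpose-matchʳ : Transposition.transpose i j j ≡ i
  transpose-matchʳ with j ≟ i
  ... | yes j≡i = j≡i
  ... | no _ with j ≟ j
  ...   | yes _   = refl
  ...   | no j≢j = ⊥-elim (j≢j refl)

  transpose-other : ∀ {k} → k ≢ i → k ≢ j → Transposition.transpose i j k ≡ k
  transpose-other {k} k≢i k≢j with k ≟ i
  ... | yes k≡i = ⊥-elim (k≢i k≡i)
  ... | no _ with k ≟ j
  ...   | yes k≡j = ⊥-elim (k≢j k≡j)
  ...   | no _    = refl

module _ {n} (u v : Fin n) where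

  redirect : Fin n → Fin n
  redirect x with x ≟ v
  ... | yes _ = u
  ... | no _  = x

  redirect-target : ∀ {x} → x ≡ v → redirect x ≡ u
  redirect-target {x} x≡v with x ≟ v
  ... | yes _   = refl
  ... | no x≢v = ⊥-elim (x≢v x≡v)

  redirect-other : ∀ {x} → x ≢ v → redirect x ≡ x
  redirect-other {x} x≢v with x ≟ v
  ... | yes x≡v = ⊥-elim (x≢v x≡v)
  ... | no _    = refl

  redirect-transpose : u ≢ v → ∀ x → redirect (transpose u v ⟨$⟩ʳ x) ≡ redirect x
  redirect-transpose u≢v x = by-cases (x ≟ u) (x ≟ v)
    where
    by-cases : Dec (x ≡ u) → Dec (x ≡ v) → redirect (transpose u v ⟨$⟩ʳ x) ≡ redirect x
    by-cases (yes refl) _       =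
      trans (cong redirect (transpose-matchˡ u v)) (trans (redirect-target refl) (sym (redirect-other u≢v)))
    by-cases (no _) (yes refl)  =
      trans (cong redirect (transpose-matchʳ u v)) (trans (redirect-other u≢v) (sym (redirect-target refl)))
    by-cases (no x≢u) (no x≢v) = cong redirect (transpose-other u v x≢u x≢v)

clone : ∀ {n} → Graph n → Fin n → Fin n → Graph n
clone G u v = record
  { adj    = λ x y → adj G (redirect u v x) (redirect u v y)
  ; sym    = λ x y → Graph.sym G (redirect u v x) (redirect u v y)
  ; irrefl = λ x → Graph.irrefl G (redirect u v x)
  }

Twins : ∀ {n} → Graph n → Fin n → Fin n → Set
Twins {n} G x y = ∀ (z : Fin n) → adj G x z ≡ adj G y z

module _ {n} (G : Graph n) where

  twins? : ∀ x y → Dec (Twins G x y)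
  twins? x y = all? (λ z → adj G x z Bool.≟ adj G y z)

  twins-sym : ∀ {x y} → Twins G x y → Twins G y x
  twins-sym x~y z = sym (x~y z)

  twins-trans : ∀ {x y z} → Twins G x y → Twins G y z → Twins G x z
  twins-trans x~y y~z w = trans (x~y w) (y~z w)

  twins⇒nonadjacent : ∀ {x y} → Twins G x y → adj G x y ≡ false
  twins⇒nonadjacent {x} {y} x~y = trans (x~y y) (Graph.irrefl G y)

  adjacent⇒distinct : ∀ {x y} → adj G x y ≡ true → x ≢ y
  adjacent⇒distinct {x} xy refl with () ← trans (sym xy) (Graph.irrefl G x)

module _ {n} (G : Graph n) (u v : Fin n) where

  clone-twins : ∀ x y → Twins G (redirect u v x) (redirect u v y) → Twins (clone G u v) x y
  clone-twins x y x~y z = x~y (redirect u v z)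

  clone-KFree : ∀ k → KFree k G → KFree k (clone G u v)
  clone-KFree k free (f , f-injective , clique) = free (redirect u v ∘ f , injective , clique)
    where
    injective : Injective (redirect u v ∘ f)
    injective i j eq with i ≟ j
    ... | yes i≡j = i≡j
    ... | no i≢j  = ⊥-elim (adjacent⇒distinct G (clique i j i≢j) eq)

  clone-independent : ∀ {a} {A : Fin a → Fin n} → IsIndependentSet G A →
                      (∀ i → A i ≡ v → ∀ j → adj G u (A j) ≡ false) → IsIndependentSet (clone G u v) A
  clone-independent {A = A} (A-injective , independent) u-replaces-v =
    A-injective , λ i j → by-cases i j (A i ≟ v) (A j ≟ v)
    where
    by-cases : ∀ i j → Dec (A i ≡ v) → Dec (A j ≡ v) → adj G (redirect u v (A i)) (redirect u v (A j)) ≡ false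
    by-cases i j (yes Ai≡v) (yes Aj≡v) = subst₂ (λ x y → adj G x y ≡ false)
      (sym (redirect-target u v Ai≡v))
      (sym (redirect-target u v Aj≡v)) (Graph.irrefl G u)
    by-cases i j (yes Ai≡v) (no Aj≢v) = subst₂ (λ x y → adj G x y ≡ false)
      (sym (redirect-target u v Ai≡v))
      (sym (redirect-other u v Aj≢v)) (u-replaces-v i Ai≡v j)
    by-cases i j (no Ai≢v) (yes Aj≡v) = subst₂ (λ x y → adj G x y ≡ false)
      (sym (redirect-other u v Ai≢v))
      (sym (redirect-target u v Aj≡v))
      (trans (Graph.sym G (A i) u) (u-replaces-v j Aj≡v i))
    by-cases i j (no Ai≢v) (no Aj≢v) = subst₂ (λ x y → adj G x y ≡ false)
      (sym (redirect-other u v Ai≢v)) (sym (redirect-other u v Aj≢v)) (independent i j)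

hom-reflects-nonadjacent : ∀ {h n} {H : Graph h} {G : Graph n} {f : Fin h → Fin n} → IsHomomorphism H G f →
                           ∀ i j → adj G (f i) (f j) ≡ false → adj H i j ≡ false
hom-reflects-nonadjacent {H = H} hom i j Gfifj with adj H i j in Hij
... | false = refl
... | true with () ← trans (sym (hom i j Hij)) Gfifj

module _ {h n} {H : Graph h} (G : Graph n) (u v : Fin n) {f : Fin h → Fin n} (hom : IsHomomorphism H G f) where

  private
    clone-edge-avoiding : ∀ {i j} → adj H i j ≡ true → f i ≢ v → f j ≢ v →
                          adj G (redirect u v (f i)) (redirect u v (f j)) ≡ true
    clone-edge-avoiding {i} {j} Hij fi≢v fj≢v = subst₂ (λ x y → adj G x y ≡ true)
      (sym (redirect-other u v fi≢v)) (sym (redirect-other u v fj≢v)) (hom i j Hij)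

  clone-hom-avoiding : (∀ i → f i ≢ v) → IsHomomorphism H (clone G u v) f
  clone-hom-avoiding f≢v i j Hij = clone-edge-avoiding Hij (f≢v i) (f≢v j)

  clone-hom-transposed : u ≢ v → (∀ i → f i ≢ v) → IsHomomorphism H (clone G u v) (λ i → transpose u v ⟨$⟩ʳ f i)
  clone-hom-transposed u≢v f≢v i j Hij = subst₂ (λ x y → adj G x y ≡ true)
    (sym (redirect-transpose u v u≢v (f i))) (sym (redirect-transpose u v u≢v (f j))) (clone-hom-avoiding f≢v i j Hij)

  clone-hom-twins : Injective f → ∀ {iᵤ iᵥ} → f iᵤ ≡ u → f iᵥ ≡ v → Twins H iᵤ iᵥ →
                    IsHomomorphism H (clone G u v) f
  clone-hom-twins f-injective {iᵤ} {iᵥ} fiᵤ≡u fiᵥ≡v iᵤ~iᵥ i j Hij = by-cases (f i ≟ v) (f j ≟ v)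
    where
    at-iᵥ : ∀ {k} → f k ≡ v → k ≡ iᵥ
    at-iᵥ fk≡v = f-injective _ _ (trans fk≡v (sym fiᵥ≡v))
    redirect-at : ∀ {k} → f k ≡ v → redirect u v (f k) ≡ f iᵤ
    redirect-at fk≡v = trans (redirect-target u v fk≡v) (sym fiᵤ≡u)
    by-cases : Dec (f i ≡ v) → Dec (f j ≡ v) → adj G (redirect u v (f i)) (redirect u v (f j)) ≡ true
    by-cases (yes fi≡v) (yes fj≡v) with refl ← trans (at-iᵥ fi≡v) (sym (at-iᵥ fj≡v))
      with () ← trans (sym Hij) (Graph.irrefl H i)
    by-cases (yes fi≡v) (no fj≢v) =
      subst₂ (λ x y → adj G x y ≡ true) (sym (redirect-at fi≡v)) (sym (redirect-other u v fj≢v))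
        (hom iᵤ j (trans (iᵤ~iᵥ j) (subst (λ k → adj H k j ≡ true) (at-iᵥ fi≡v) Hij)))
    by-cases (no fi≢v) (yes fj≡v) =
      subst₂ (λ x y → adj G x y ≡ true) (sym (redirect-other u v fi≢v)) (sym (redirect-at fj≡v))
        (hom i iᵤ (trans (Graph.sym H i iᵤ) (trans (iᵤ~iᵥ i)
          (trans (Graph.sym H iᵥ i) (subst (λ k → adj H i k ≡ true) (at-iᵥ fj≡v) Hij)))))
    by-cases (no fi≢v) (no fj≢v) = clone-edge-avoiding Hij fi≢v fj≢v

multipartite-nonadjacent⇒twins : ∀ {h m} {H : Graph h} {q : Fin h → Fin m} → IsCompletePartiteVia m H q →
                                 ∀ {i j} → adj H i j ≡ false → Twins H i j
multipartite-nonadjacent⇒twins {H = H} {q} partite {i} {j} Hij≡false z = ⇔→≡ {z = true} $ mk⇔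
  (λ Hiz → Equivalence.from (partite j z) (λ qj≡qz → Equivalence.to (partite i z) Hiz (trans same-part qj≡qz)))
  (λ Hjz → Equivalence.from (partite i z) (λ qi≡qz → Equivalence.to (partite j z) Hjz (trans (sym same-part) qi≡qz)))
  where
  same-part : q i ≡ q j
  same-part with q i ≟ q j
  ... | yes qi≡qj = qi≡qj
  ... | no qi≢qj with () ← trans (sym (Equivalence.from (partite i j) qi≢qj)) Hij≡false

-- Copies under cloning

module _ {h} (H : Graph h) {n : ℕ} where

  copyIn : Graph n → Candidate n → Bool
  copyIn K c = isCopy H K (proj₁ c) (proj₂ c)

  contains : Fin n → Candidate n → Bool
  contains x c = lookup (proj₁ c) x

  throughAvoiding : Graph n → Fin n → Fin n → ℕ
  throughAvoiding K a b = count (λ c → (copyIn K c ∧ contains a c) ∧ not (contains b c)) (candidates n)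

  𝒩-decomposition : ∀ K a b → 𝒩 H K ≡
    (count (λ c → (copyIn K c ∧ contains a c) ∧ contains b c) (candidates n) + throughAvoiding K a b)
    + count (λ c → copyIn K c ∧ not (contains a c)) (candidates n)
  𝒩-decomposition K a b = begin
    𝒩 H K                           ≡⟨ count-cong _ (copyIn K) (candidates n) (λ _ → refl) ⟩
    count (copyIn K) (candidates n) ≡⟨ count-split (copyIn K) (contains a) (candidates n) ⟩
    _                               ≡⟨ cong (_+ count (λ c → copyIn K c ∧ not (contains a c)) (candidates n))
                                            (count-split (λ c → copyIn K c ∧ contains a c) (contains b) (candidates n)) ⟩
    _                               ∎
    where open ≡-Reasoning

module _ {h m} {H : Graph h} {q : Fin h → Fin m} (H-partite : IsCompletePartiteVia m H q)
         {n} {G : Graph n} {u v : Fin n} (u≢v : u ≢ v) (Guv≡false : adj G u v ≡ false) where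

  private
    L = candidates n
    G′ = clone G u v

    not-true : ∀ {b} → not b ≡ true → b ≡ false
    not-true {false} _ = refl

    true-not : ∀ {b} → b ≡ false → not b ≡ true
    true-not refl = refl

    avoids : ∀ {S E} (c : Copy H S E) → lookup S v ≡ false → ∀ i → Copy.embed c i ≢ v
    avoids c Sv≡false i refl with () ← trans (sym (Copy.image⁻ c i)) Sv≡false

  copy-avoiding-survives : ∀ S E → isCopy H G S E ≡ true → lookup S v ≡ false → isCopy H G′ S E ≡ true
  copy-avoiding-survives S E copy v∉ =
    Copy⇒isCopy H G′ S E c (clone-hom-avoiding {H = H} G u v hom (avoids c v∉))
    where open CopyIn H G S E copy

  copy-through-both-survives : ∀ S E → isCopy H G S E ≡ true → lookup S v ≡ true → lookup S u ≡ true →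
                               isCopy H G′ S E ≡ true
  copy-through-both-survives S E copy v∈ u∈ = Copy⇒isCopy H G′ S E c
    (clone-hom-twins {H = H} G u v hom embed-injective fiᵤ≡u fiᵥ≡v
      (multipartite-nonadjacent⇒twins {H = H} {q} H-partite nonadjacent))
    where
    open CopyIn H G S E copy
    iᵤ iᵥ : Fin h
    iᵤ = proj₁ (image⁺ u u∈)
    iᵥ = proj₁ (image⁺ v v∈)
    fiᵤ≡u : embed iᵤ ≡ u
    fiᵤ≡u = proj₂ (image⁺ u u∈)
    fiᵥ≡v : embed iᵥ ≡ v
    fiᵥ≡v = proj₂ (image⁺ v v∈)
    nonadjacent : adj H iᵤ iᵥ ≡ false
    nonadjacent = hom-reflects-nonadjacent {H = H} {G} hom iᵤ iᵥ
      (subst₂ (λ x y → adj G x y ≡ false) (sym fiᵤ≡u) (sym fiᵥ≡v) Guv≡false)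

  copy-through-u-transposes : ∀ S E → isCopy H G S E ≡ true → lookup S v ≡ false →
                              copyIn H G′ (relabel (transpose u v) (S , E)) ≡ true
  copy-through-u-transposes S E copy v∉ =
    Copy⇒isCopy H G′ (proj₁ (relabel (transpose u v) (S , E))) (proj₂ (relabel (transpose u v) (S , E)))
      (Copy-relabel (transpose u v) c) (clone-hom-transposed {H = H} G u v hom u≢v (avoids c v∉))
    where open CopyIn H G S E copy

  copies-avoiding-survive : count (λ c → copyIn H G c ∧ not (contains H v c)) L
                          ≤ count (λ c → copyIn H G′ c ∧ not (contains H v c)) L
  copies-avoiding-survive = count-mono _ _ L λ (S , E) copy∧v∉ →
    let copy , v∉ = ∧-elim {isCopy H G S E} {not (lookup S v)} copy∧v∉
    in ∧-intro (copy-avoiding-survives S E copy (not-true v∉)) v∉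

  copies-through-both-survive : count (λ c → (copyIn H G c ∧ contains H v c) ∧ contains H u c) L
                              ≤ count (λ c → (copyIn H G′ c ∧ contains H v c) ∧ contains H u c) L
  copies-through-both-survive = count-mono _ _ L λ (S , E) copy∧v∈∧u∈ →
    let copy∧v∈ , u∈ = ∧-elim {isCopy H G S E ∧ lookup S v} {lookup S u} copy∧v∈∧u∈
        copy , v∈ = ∧-elim {isCopy H G S E} {lookup S v} copy∧v∈
    in ∧-intro (∧-intro (copy-through-both-survives S E copy v∈ u∈) v∈) u∈

  copies-through-u-transpose : throughAvoiding H G u v ≤ throughAvoiding H G′ v u
  copies-through-u-transpose = count-mono-injection (candidates-unique n) (relabel π) (relabel-injective π)
    (λ c → ∈-candidates (relabel π c)) _ _ λ (S , E) copy∧u∈∧v∉ →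
    let copy∧u∈ , v∉ = ∧-elim {isCopy H G S E ∧ lookup S u} {not (lookup S v)} copy∧u∈∧v∉
        copy , u∈ = ∧-elim {isCopy H G S E} {lookup S u} copy∧u∈
    in ∧-intro (∧-intro (copy-through-u-transposes S E copy (not-true v∉))
                         (trans (lookup-relabel π (S , E) v) (trans (cong (lookup S) (transpose-matchˡ v u)) u∈)))
               (true-not (trans (lookup-relabel π (S , E) u) (trans (cong (lookup S) (transpose-matchʳ v u)) (not-true v∉))))
    where π = transpose u v

  𝒩-clone : 𝒩 H G + throughAvoiding H G u v ≤ 𝒩 H G′ + throughAvoiding H G v u
  𝒩-clone = begin
    𝒩 H G + D G u v                    ≡⟨ cong (_+ D G u v) (𝒩-decomposition H G v u) ⟩
    (B G + D G v u) + A G + D G u v    ≡⟨ swap-middle (B G) (D G v u) (A G) (D G u v) ⟩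
    (B G + D G u v) + A G + D G v u    ≤⟨ +-monoˡ-≤ (D G v u) (+-mono-≤
                                            (+-mono-≤ copies-through-both-survive copies-through-u-transpose)
                                            copies-avoiding-survive) ⟩
    (B G′ + D G′ v u) + A G′ + D G v u ≡⟨ cong (_+ D G v u) (𝒩-decomposition H G′ v u) ⟨
    𝒩 H G′ + D G v u                   ∎
    where
    open ≤-Reasoning
    D = throughAvoiding H
    A B : Graph n → ℕ
    A K = count (λ c → copyIn H K c ∧ not (contains H v c)) L
    B K = count (λ c → (copyIn H K c ∧ contains H v c) ∧ contains H u c) L
    swap-middle : ∀ b d a d′ → (b + d) + a + d′ ≡ (b + d′) + a + d
    swap-middle = solve-∀

-- Twin pairs

𝟙 : {P : Set} → Dec P → ℕ
𝟙 (yes _) = 1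
𝟙 (no _)  = 0

𝟙-mono : {P Q : Set} → (P → Q) → (p : Dec P) (q : Dec Q) → 𝟙 p ≤ 𝟙 q
𝟙-mono P⇒Q (yes p) (yes _) = ≤-refl
𝟙-mono P⇒Q (yes p) (no ¬q) = ⊥-elim (¬q (P⇒Q p))
𝟙-mono P⇒Q (no _)  _       = z≤n

𝟙-yes : {P : Set} → P → (p : Dec P) → 𝟙 p ≡ 1
𝟙-yes _  (yes _) = refl
𝟙-yes p′ (no ¬p) = ⊥-elim (¬p p′)

𝟙-no : {P : Set} → ¬ P → (p : Dec P) → 𝟙 p ≡ 0
𝟙-no ¬p (yes p) = ⊥-elim (¬p p)
𝟙-no _  (no _)  = refl

𝟙-cong : {P Q : Set} → (P → Q) → (Q → P) → (p : Dec P) (q : Dec Q) → 𝟙 p ≡ 𝟙 q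
𝟙-cong P⇒Q Q⇒P p q = ≤-antisym (𝟙-mono P⇒Q p q) (𝟙-mono Q⇒P q p)

∑-mono-≤ : ∀ {m} (f g : Fin m → ℕ) → (∀ i → f i ≤ g i) → ∑[ i < m ] f i ≤ ∑[ i < m ] g i
∑-mono-≤ {zero}  f g f≤g = z≤n
∑-mono-≤ {suc m} f g f≤g = +-mono-≤ (f≤g Fin.zero) (∑-mono-≤ (f ∘ Fin.suc) (g ∘ Fin.suc) (f≤g ∘ Fin.suc))

∑-bounded : ∀ {m} (f : Fin m → ℕ) c → (∀ i → f i ≤ c) → ∑[ i < m ] f i ≤ m * c
∑-bounded {zero}  f c f≤c = z≤n
∑-bounded {suc m} f c f≤c = +-mono-≤ (f≤c Fin.zero) (∑-bounded (f ∘ Fin.suc) c (f≤c ∘ Fin.suc))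

module _ {n} (G : Graph n) where

  twinCount : Fin n → ℕ
  twinCount x = ∑[ y < n ] 𝟙 (twins? G x y)

  twinPairs : ℕ
  twinPairs = ∑[ x < n ] twinCount x

  twinPairs≤n² : twinPairs ≤ n * n
  twinPairs≤n² = ∑-bounded twinCount n λ x → subst (twinCount x ≤_) (*-identityʳ n)
    (∑-bounded (λ y → 𝟙 (twins? G x y)) 1 λ y → 𝟙≤1 (twins? G x y))
    where
    𝟙≤1 : {P : Set} (p : Dec P) → 𝟙 p ≤ 1
    𝟙≤1 (yes _) = ≤-refl
    𝟙≤1 (no _)  = z≤n

module _ {m} (G : Graph (suc m)) (v : Fin (suc m)) where

  twinsOff : ℕ
  twinsOff = ∑[ y < m ] 𝟙 (twins? G v (punchIn v y))

  twinPairsOff : ℕ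
  twinPairsOff = ∑[ x < m ] ∑[ y < m ] 𝟙 (twins? G (punchIn v x) (punchIn v y))

  twinCount-around : ∀ x → twinCount G x ≡ 𝟙 (twins? G x v) + ∑[ y < m ] 𝟙 (twins? G x (punchIn v y))
  twinCount-around x = sum-remove {i = v} (λ y → 𝟙 (twins? G x y))

  twinCount-self : twinCount G v ≡ suc twinsOff
  twinCount-self = trans (twinCount-around v) (cong (_+ twinsOff) (𝟙-yes (λ _ → refl) (twins? G v v)))

  twinPairs-around : twinPairs G ≡ suc twinsOff + (twinsOff + twinPairsOff)
  twinPairs-around = begin
    twinPairs G
      ≡⟨ sum-remove {i = v} (twinCount G) ⟩
    twinCount G v + ∑[ x < m ] twinCount G (punchIn v x)
      ≡⟨ cong₂ _+_ twinCount-self (sum-cong-≗ (twinCount-around ∘ punchIn v)) ⟩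
    suc twinsOff + ∑[ x < m ] (𝟙 (twins? G (punchIn v x) v) + ∑[ y < m ] 𝟙 (twins? G (punchIn v x) (punchIn v y)))
      ≡⟨ cong (suc twinsOff +_) (∑-distrib-+ (λ x → 𝟙 (twins? G (punchIn v x) v))
                                                 (λ x → ∑[ y < m ] 𝟙 (twins? G (punchIn v x) (punchIn v y)))) ⟩
    suc twinsOff + (∑[ x < m ] 𝟙 (twins? G (punchIn v x) v) + twinPairsOff)
      ≡⟨ cong (λ t → suc twinsOff + (t + twinPairsOff)) (sum-cong-≗ λ x →
           𝟙-cong (twins-sym G) (twins-sym G) (twins? G (punchIn v x) v) (twins? G v (punchIn v x))) ⟩
    suc twinsOff + (twinsOff + twinPairsOff)
      ∎
    where open ≡-Reasoning

twinPairs-clone : ∀ {n} (G : Graph n) (u v : Fin n) → ¬ Twins G u v → twinCount G v ≤ twinCount G u →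
                  twinPairs G < twinPairs (clone G u v)
twinPairs-clone {suc m} G u v u≁v v≼u = begin-strict
  twinPairs G                ≡⟨ twinPairs-around G v ⟩
  suc (X G) + (X G + R G)    <⟨ +-mono-<-≤ (s≤s X<X′) (+-mono-≤ (<⇒≤ X<X′) R≤R′) ⟩
  suc (X G′) + (X G′ + R G′) ≡⟨ twinPairs-around G′ v ⟨
  twinPairs G′               ∎
  where
  open ≤-Reasoning
  G′ = clone G u v
  X R : Graph (suc m) → ℕ
  X K = twinsOff K v
  R K = twinPairsOff K v
  redirect-punchIn : ∀ y → redirect u v (punchIn v y) ≡ punchIn v y
  redirect-punchIn y = redirect-other u v (punchInᵢ≢i v y)
  twin-of-u⇒twin-of-v : ∀ y → Twins G u (punchIn v y) → Twins G′ v (punchIn v y)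
  twin-of-u⇒twin-of-v y u~y = clone-twins G u v v (punchIn v y)
    (subst₂ (Twins G) (sym (redirect-target u v refl)) (sym (redirect-punchIn y)) u~y)
  twins-kept : ∀ x y → Twins G (punchIn v x) (punchIn v y) → Twins G′ (punchIn v x) (punchIn v y)
  twins-kept x y x~y = clone-twins G u v (punchIn v x) (punchIn v y)
    (subst₂ (Twins G) (sym (redirect-punchIn x)) (sym (redirect-punchIn y)) x~y)
  X<X′ : X G < X G′
  X<X′ = begin-strict
    X G                                                     <⟨ s≤s ≤-refl ⟩
    suc (X G)                                               ≡⟨ twinCount-self G v ⟨
    twinCount G v                                           ≤⟨ v≼u ⟩
    twinCount G u                                           ≡⟨ twinCount-around G v u ⟩
    𝟙 (twins? G u v) + ∑[ y < m ] 𝟙 (twins? G u (punchIn v y))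
      ≡⟨ cong (_+ ∑[ y < m ] 𝟙 (twins? G u (punchIn v y))) (𝟙-no u≁v (twins? G u v)) ⟩
    ∑[ y < m ] 𝟙 (twins? G u (punchIn v y))
      ≤⟨ ∑-mono-≤ _ _ (λ y → 𝟙-mono (twin-of-u⇒twin-of-v y) (twins? G u (punchIn v y)) (twins? G′ v (punchIn v y))) ⟩
    X G′                                                    ∎
  R≤R′ : R G ≤ R G′
  R≤R′ = ∑-mono-≤ _ _ λ x → ∑-mono-≤ _ _ λ y →
    𝟙-mono (twins-kept x y) (twins? G (punchIn v x) (punchIn v y)) (twins? G′ (punchIn v x) (punchIn v y))

-- Twin classes

module _ {a ℓ} (S : Setoid a ℓ) where

  open Setoid S using (_≈_)
  open import Data.List.Relation.Unary.Unique.Setoid S as Distinct using ()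

  lookup-injective : ∀ {xs} → Distinct.Unique xs → ∀ i j → List.lookup xs i ≈ List.lookup xs j → i ≡ j
  lookup-injective (x≉xs ∷ _)   Fin.zero    Fin.zero    _   = refl
  lookup-injective (x≉xs ∷ _)   Fin.zero    (Fin.suc j) x≈y = ⊥-elim (All.lookup x≉xs (∈-lookup j) x≈y)
  lookup-injective (x≉xs ∷ _)   (Fin.suc i) Fin.zero    y≈x = ⊥-elim (All.lookup x≉xs (∈-lookup i) (Setoid.sym S y≈x))
  lookup-injective (_ ∷ !xs)    (Fin.suc i) (Fin.suc j) x≈y = cong Fin.suc (lookup-injective !xs i j x≈y)

NonadjacentAreTwins : ∀ {n} → Graph n → Set
NonadjacentAreTwins G = ∀ x y → adj G x y ≡ false → Twins G x y

module TwinClasses {n} (G : Graph n) (closed : NonadjacentAreTwins G) where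

  twinsDecSetoid : DecSetoid 0ℓ 0ℓ
  twinsDecSetoid = record
    { Carrier          = Fin n
    ; _≈_              = Twins G
    ; isDecEquivalence = record
      { isEquivalence = record { refl = λ _ → refl ; sym = twins-sym G ; trans = twins-trans G }
      ; _≟_           = twins? G
      }
    }

  classes : List (Fin n)
  classes = deduplicate (twins? G) (allFin n)

  classes-distinct : ∀ i j → Twins G (List.lookup classes i) (List.lookup classes j) → i ≡ j
  classes-distinct = lookup-injective (DecSetoid.setoid twinsDecSetoid) (deduplicate-! twinsDecSetoid (allFin n))

  twin-in-classes : ∀ x → Any (Twins G x) classes
  twin-in-classes x = deduplicate⁺ (twins? G) (λ y~z x~y → twins-trans G x~y (twins-sym G y~z))
                                   (Any.map (λ { refl → λ _ → refl }) (∈-allFin x))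

  classOf : Fin n → Fin (length classes)
  classOf x = Any.index (twin-in-classes x)

  twins-classOf : ∀ x → Twins G x (List.lookup classes (classOf x))
  twins-classOf x = lookup-index (twin-in-classes x)

  classOf-≡⇒twins : ∀ x y → classOf x ≡ classOf y → Twins G x y
  classOf-≡⇒twins x y cx≡cy = twins-trans G (twins-classOf x)
    (subst (λ c → Twins G (List.lookup classes c) y) (sym cx≡cy) (twins-sym G (twins-classOf y)))

  twins⇒classOf-≡ : ∀ x y → Twins G x y → classOf x ≡ classOf y
  twins⇒classOf-≡ x y x~y = classes-distinct (classOf x) (classOf y)
    (twins-trans G (twins-sym G (twins-classOf x)) (twins-trans G x~y (twins-classOf y)))

  classes-adjacent : ∀ i j → i ≢ j → adj G (List.lookup classes i) (List.lookup classes j) ≡ true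
  classes-adjacent i j i≢j with adj G (List.lookup classes i) (List.lookup classes j) in Gij
  ... | true  = refl
  ... | false = ⊥-elim (i≢j (classes-distinct i j (closed _ _ Gij)))

  classes-bounded : ∀ r → KFree (suc r) G → length classes ≤ r
  classes-bounded r free with length classes ≤? r
  ... | yes ≤r = ≤r
  ... | no  ≰r = ⊥-elim (free (clique , clique-injective , λ i j i≢j →
                   classes-adjacent _ _ (i≢j ∘ inject≤-injective′ i j)))
    where
    r<length : suc r ≤ length classes
    r<length = ≰⇒> ≰r
    inject≤-injective′ : ∀ i j → inject≤ i r<length ≡ inject≤ j r<length → i ≡ j
    inject≤-injective′ = inject≤-injective r<length r<length
    clique : Fin (suc r) → Fin n
    clique i = List.lookup classes (inject≤ i r<length)
    clique-injective : Injective clique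
    clique-injective i j eq = inject≤-injective′ i j (classes-distinct _ _ (λ z → cong (λ w → adj G w z) eq))

  module _ r (free : KFree (suc r) G) where

    partition : Fin n → Fin r
    partition x = inject≤ (classOf x) (classes-bounded r free)

    nonadjacent⇒same-part : ∀ x y → adj G x y ≡ false → partition x ≡ partition y
    nonadjacent⇒same-part x y Gxy = cong (λ c → inject≤ c (classes-bounded r free)) (twins⇒classOf-≡ x y (closed x y Gxy))

    partition-complete : IsCompletePartiteVia r G partition
    partition-complete x y = mk⇔
      (λ Gxy px≡py → true≢false (trans (sym Gxy) (twins⇒nonadjacent G (classOf-≡⇒twins x y
                       (inject≤-injective _ _ (classOf x) (classOf y) px≡py)))))
      (λ px≢py → adjacent px≢py)
      where
      true≢false : true ≢ false
      true≢false ()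
      adjacent : partition x ≢ partition y → adj G x y ≡ true
      adjacent px≢py with adj G x y in Gxy
      ... | true  = refl
      ... | false = ⊥-elim (px≢py (nonadjacent⇒same-part x y Gxy))

partSize-≥ : ∀ {a n m} (p : Fin n → Fin m) c (A : Fin a → Fin n) → Injective A → (∀ i → p (A i) ≡ c) →
             a ≤ partSize p c
partSize-≥ {a} {n} p c A A-injective A⊆c = subst (_≤ partSize p c) (trans (length-map A (allFin a)) (length-tabulate id))
  (length-mono-⊆ (Unique.map⁺ (λ {i} {j} → A-injective i j) (Unique.allFin⁺ a)) A⊆part)
  where
  A⊆part : map A (allFin a) ⊆ filterᵇ (λ u → p u == c) (allFin n)
  A⊆part x∈ with i , _ , refl ← ∈-map⁻ A x∈ =
    ∈-filter⁺ (λ u → T? (p u == c)) (∈-allFin (A i)) (Equivalence.from T-≡ (==-complete (A⊆c i)))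

-- Symmetrization

module _ {S : Set} (μ : S → ℕ) (bound : ℕ) (μ≤bound : ∀ s → μ s ≤ bound) {Goal : S → Set}
         (improve : ∀ s → Goal s ⊎ Σ S λ s′ → μ s < μ s′) where

  climb : S → Σ S Goal
  climb s = go s (On.wellFounded (λ s → bound ∸ μ s) <-wellFounded s)
    where
    go : ∀ s → Acc (_<_ on λ s → bound ∸ μ s) s → Σ S Goal
    go s (acc rec) with improve s
    ... | inj₁ goal         = s , goal
    ... | inj₂ (s′ , μs<μs′) = go s′ (rec (∸-monoʳ-< μs<μs′ (μ≤bound s′)))

lex-<ˡ : ∀ M {a a′ b b′} → b < M → a < a′ → a * M + b < a′ * M + b′
lex-<ˡ M {a} {a′} {b} {b′} b<M a<a′ = begin-strict
  a * M + b   <⟨ +-monoʳ-< (a * M) b<M ⟩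
  a * M + M   ≡⟨ +-comm (a * M) M ⟩
  suc a * M   ≤⟨ *-monoˡ-≤ M a<a′ ⟩
  a′ * M      ≤⟨ m≤m+n (a′ * M) b′ ⟩
  a′ * M + b′ ∎
  where open ≤-Reasoning

lex-<ʳ : ∀ M {a a′ b b′} → a ≤ a′ → b < b′ → a * M + b < a′ * M + b′
lex-<ʳ M a≤a′ b<b′ = +-mono-≤-< (*-monoˡ-≤ M a≤a′) b<b′

module Symmetrization {h m k a n : ℕ} {H : Graph h} {q : Fin h → Fin m} (H-partite : IsCompletePartiteVia m H q)
                      (G₀ : Graph n) (A : Fin a → Fin n) where

  record State : Set where
    field
      graph       : Graph n
      K-free      : KFree k graph
      independent : IsIndependentSet graph A
      dominates   : 𝒩 H G₀ ≤ 𝒩 H graph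

  open State

  scale : ℕ
  scale = suc (n * n)

  potential : Graph n → ℕ
  potential K = 𝒩 H K * scale + twinPairs K

  potential-bounded : ∀ K → potential K ≤ length (candidates n) * scale + n * n
  potential-bounded K = +-mono-≤ (*-monoˡ-≤ scale (count≤length _ (candidates n))) (twinPairs≤n² K)

  Improves : State → Set
  Improves s = Σ State λ s′ → potential (graph s) < potential (graph s′)

  Replaces : Graph n → Fin n → Fin n → Set
  Replaces G u v = ∀ i → A i ≡ v → ∀ j → adj G u (A j) ≡ false

  module _ (s : State) where

    private
      G = graph s
      D = throughAvoiding H G

    clone-state : ∀ u v → Replaces G u v → 𝒩 H G ≤ 𝒩 H (clone G u v) → State
    clone-state u v u↦v 𝒩≤ = record
      { graph       = clone G u v
      ; K-free      = clone-KFree G u v k (K-free s)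
      ; independent = clone-independent G u v (independent s) u↦v
      ; dominates   = ≤-trans (dominates s) 𝒩≤
      }

    clone-improves : ∀ u v → adj G u v ≡ false → ¬ Twins G u v → Replaces G u v → D v u ≤ D u v →
                     D v u < D u v ⊎ twinCount G v ≤ twinCount G u → Improves s
    clone-improves u v Guv u≁v u↦v Dvu≤Duv progress = clone-state u v u↦v 𝒩≤ , by-progress progress
      where
      u≢v : u ≢ v
      u≢v refl = u≁v (λ _ → refl)
      gain : 𝒩 H G + D u v ≤ 𝒩 H (clone G u v) + D v u
      gain = 𝒩-clone {H = H} {q} H-partite {G = G} u≢v Guv
      𝒩≤ : 𝒩 H G ≤ 𝒩 H (clone G u v)
      𝒩≤ = +-cancelʳ-≤ (D u v) _ _ (≤-trans gain (+-monoʳ-≤ _ Dvu≤Duv))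
      by-progress : D v u < D u v ⊎ twinCount G v ≤ twinCount G u → potential G < potential (clone G u v)
      by-progress (inj₁ Dvu<Duv) = lex-<ˡ scale (s≤s (twinPairs≤n² G))
        (+-cancelʳ-< (D u v) _ _ (≤-<-trans gain (+-monoʳ-< _ Dvu<Duv)))
      by-progress (inj₂ v≼u)     = lex-<ʳ scale 𝒩≤ (twinPairs-clone G u v u≁v v≼u)

    symmetrize-pair : ∀ u v → adj G u v ≡ false → ¬ Twins G u v → Replaces G u v → Replaces G v u → Improves s
    symmetrize-pair u v Guv u≁v u↦v v↦u = by-order (<-cmp (D v u) (D u v))
      where
      Gvu : adj G v u ≡ false
      Gvu = trans (Graph.sym G v u) Guv
      v≁u : ¬ Twins G v u
      v≁u = u≁v ∘ twins-sym G
      by-order : Tri (D v u < D u v) (D v u ≡ D u v) (D u v < D v u) → Improves s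
      by-order (tri< lt _ _) = clone-improves u v Guv u≁v u↦v (<⇒≤ lt) (inj₁ lt)
      by-order (tri> _ _ gt) = clone-improves v u Gvu v≁u v↦u (<⇒≤ gt) (inj₁ gt)
      by-order (tri≈ _ eq _) = by-twins (≤-total (twinCount G v) (twinCount G u))
        where
        by-twins : twinCount G v ≤ twinCount G u ⊎ twinCount G u ≤ twinCount G v → Improves s
        by-twins (inj₁ v≼u) = clone-improves u v Guv u≁v u↦v (≤-reflexive eq) (inj₂ v≼u)
        by-twins (inj₂ u≼v) = clone-improves v u Gvu v≁u v↦u (≤-reflexive (sym eq)) (inj₂ u≼v)

  improve : ∀ s → NonadjacentAreTwins (graph s) ⊎ Improves s
  improve s = by-independent-twins (all? λ i → all? λ j → twins? G (A i) (A j))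
    where
    G = graph s
    A-independent : ∀ i j → adj G (A i) (A j) ≡ false
    A-independent = proj₂ (independent s)
    closed-at? : ∀ x y → Dec (adj G x y ≡ false → Twins G x y)
    closed-at? x y = (adj G x y Bool.≟ false) →-dec twins? G x y
    by-closed : (∀ i j → Twins G (A i) (A j)) → Dec (NonadjacentAreTwins G) → NonadjacentAreTwins G ⊎ Improves s
    by-closed _ (yes closed) = inj₁ closed
    by-closed A-twins (no not-closed)
      with x , ¬x ← ¬∀⟶∃¬ _ _ (λ x → all? (closed-at? x)) not-closed
      with y , ¬xy ← ¬∀⟶∃¬ _ _ (closed-at? x) ¬x =
      inj₂ (symmetrize-pair s x y Gxy (¬xy ∘ const) (replaces Gxy) (replaces (trans (Graph.sym G y x) Gxy)))
      where
      Gxy : adj G x y ≡ false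
      Gxy = decidable-stable (adj G x y Bool.≟ false) (λ Gxy≢false → ¬xy (⊥-elim ∘ Gxy≢false))
      replaces : ∀ {u v} → adj G u v ≡ false → Replaces G u v
      replaces {u} {v} Guv i refl j = begin
        adj G u (A j) ≡⟨ Graph.sym G u (A j) ⟩
        adj G (A j) u ≡⟨ A-twins j i u ⟩
        adj G (A i) u ≡⟨ Graph.sym G (A i) u ⟩
        adj G u (A i) ≡⟨ Guv ⟩
        false         ∎
        where open ≡-Reasoning
    by-independent-twins : Dec (∀ i j → Twins G (A i) (A j)) → NonadjacentAreTwins G ⊎ Improves s
    by-independent-twins (yes A-twins) =
      by-closed A-twins (all? λ x → all? (closed-at? x))
    by-independent-twins (no ¬A-twins)
      with i , ¬i ← ¬∀⟶∃¬ _ _ (λ i → all? λ j → twins? G (A i) (A j)) ¬A-twins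
      with j , ¬ij ← ¬∀⟶∃¬ _ _ (λ j → twins? G (A i) (A j)) ¬i =
      inj₂ (symmetrize-pair s (A i) (A j) (A-independent i j) ¬ij
              (λ _ _ → A-independent i) (λ _ _ → A-independent j))

  symmetrize : State → Σ State (NonadjacentAreTwins ∘ graph)
  symmetrize = climb (potential ∘ graph) _ (potential-bounded ∘ graph) improve

proposition4p4 : (k n a h : ℕ) → 2 ≤ k → (G : Graph n) → KFree k G →
    (A : Fin a → Fin n) → IsIndependentSet G A →
    (H : Graph h) → IsCompleteMultipartite H →
    Σ (Graph n) λ G' → Σ (Fin n → Fin (k ∸ 1)) λ p →
      IsCompletePartiteVia (k ∸ 1) G' p × 𝒩 H G ≤ 𝒩 H G' ×
      Σ (Fin (k ∸ 1)) λ c → a ≤ partSize p c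
proposition4p4 (suc (suc r)) n a h (s≤s (s≤s z≤n)) G G-free A A-independent H (m , q , H-partite) =
  G′ , p , partition-complete (suc r) (K-free final) , dominates final , part-containing (independent final)
  where
  open Symmetrization {k = suc (suc r)} {H = H} {q} H-partite G A
  result : Σ State (NonadjacentAreTwins ∘ State.graph)
  result = symmetrize record { graph = G ; K-free = G-free ; independent = A-independent ; dominates = ≤-refl }
  final : State
  final = proj₁ result
  G′ : Graph n
  G′ = State.graph final
  open State
  open TwinClasses G′ (proj₂ result)
  p : Fin n → Fin (suc r)
  p = partition (suc r) (K-free final)
  part-containing : ∀ {a} {B : Fin a → Fin n} → IsIndependentSet G′ B → Σ (Fin (suc r)) λ c → a ≤ partSize p c
  part-containing {zero}              _                           = Fin.zero , z≤n
  part-containing {suc _} {B} (B-injective , B-independent) = p (B Fin.zero) ,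
    partSize-≥ p _ B B-injective λ i →
      nonadjacent⇒same-part (suc r) (K-free final) (B i) (B Fin.zero) (B-independent i Fin.zero)
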